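{- For any integer $n\ge 4$, $\operatorname{adim}_2(P_n)=\left\lceil\frac{n+1}{2}\right\rceil$ and $\operatorname{adim}_3(P_n)=n-\left\lfloor\frac{n-4}{5}\right\rfloor$.
   Context: $P_n$ is the path on $n$ vertices. For a graph $G=(V,E)$, $d_{G,2}(x,y)=\min\{d_G(x,y),2\}$ with $d_G$ the shortest-path distance. For distinct $x,y$, $\mathcal{C}_G(x,y)=\{z\in V: d_{G,2}(x,z)\ne d_{G,2}(y,z)\}$. A set $S\subseteq V$ is a $k$-adjacency generator if $|S\cap\mathcal{C}_G(x,y)|\ge k$ for all distinct $x,y$; $\operatorname{adim}_k(G)$ is the minimum cardinality of such a set. -}

module Defs where

open import Data.Nat using (ℕ; zero; suc; _≤_; _≟_)
open import Data.Fin using (Fin; toℕ)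
open import Data.Fin.Subset using (Subset; _∩_; ∣_∣; inside; outside)
open import Data.Vec using (tabulate)
open import Data.Bool using (Bool; true; false; if_then_else_)
open import Relation.Nullary using (¬_; Dec; does; yes; no)
open import Data.Empty using (⊥-elim)
open import Data.Bool using (_∨_)
open import Data.Bool.Properties using (∨-comm)
import Data.Nat.Properties as NP
open import Relation.Nullary.Decidable using (dec-false; dec-true)
import Relation.Binary.PropositionalEquality as Eq
open import Relation.Binary.PropositionalEquality using (_≡_; refl; cong₂)
open import Data.Product using (Σ; _×_)
import Data.Fin as F

record Graph (n : ℕ) : Set where
  field
    adj     : Fin n → Fin n → Bool
    irrefl  : ∀ x → adj x x ≡ false
    sym     : ∀ x y → adj x y ≡ adj y x
open Graph public

-- d_{G,2}(x,y) = min{d_G(x,y),2}: 0 if x = y, 1 if adjacent, 2 otherwise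
-- (distance at least 2, possibly infinite).
d2 : ∀ {n} → Graph n → Fin n → Fin n → ℕ
d2 G x y = if does (x F.≟ y) then 0 else (if adj G x y then 1 else 2)

C : ∀ {n} → Graph n → Fin n → Fin n → Subset n
C G x y = tabulate λ z → if does (d2 G x z ≟ d2 G y z) then outside else inside

IsAdjGen : ∀ {n} → Graph n → ℕ → Subset n → Set
IsAdjGen G k S = ∀ x y → ¬ (x ≡ y) → k ≤ ∣ S ∩ C G x y ∣

AdimIs : ∀ {n} → Graph n → ℕ → ℕ → Set
AdimIs G k m =
  Σ (Subset _) (λ S → IsAdjGen G k S × ∣ S ∣ ≡ m)
  × (∀ S → IsAdjGen G k S → m ≤ ∣ S ∣)

pathAdj : ∀ {n} → Fin n → Fin n → Bool
pathAdj i j = does (toℕ i ≟ suc (toℕ j)) ∨ does (suc (toℕ i) ≟ toℕ j)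

private
  n≢1+n : ∀ m → does (m ≟ suc m) ≡ false
  n≢1+n m = dec-false (m ≟ suc m) (λ p → NP.1+n≢n (Eq.sym p))

  1+n≢n : ∀ m → does (suc m ≟ m) ≡ false
  1+n≢n m = dec-false (suc m ≟ m) NP.1+n≢n

  pathIrrefl : ∀ {n} (x : Fin n) → pathAdj x x ≡ false
  pathIrrefl x = cong₂ _∨_ (n≢1+n (toℕ x)) (1+n≢n (toℕ x))

  pathSym : ∀ {n} (x y : Fin n) → pathAdj x y ≡ pathAdj y x
  pathSym x y = Eq.trans (∨-comm (does (toℕ x ≟ suc (toℕ y))) (does (suc (toℕ x) ≟ toℕ y)))
    (cong₂ _∨_ (dec-sym (suc (toℕ x)) (toℕ y)) (dec-sym (toℕ x) (suc (toℕ y))))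
    where
    dec-sym : ∀ a b → does (a ≟ b) ≡ does (b ≟ a)
    dec-sym a b = helper (a ≟ b) (b ≟ a)
      where
      helper : ∀ (d : Dec (a ≡ b)) (e : Dec (b ≡ a)) → does d ≡ does e
      helper (yes p) e = Eq.sym (dec-true e (Eq.sym p))
      helper (no q) e = Eq.sym (dec-false e (λ r → q (Eq.sym r)))

P : (n : ℕ) → Graph n
P n = record { adj = pathAdj ; irrefl = pathIrrefl ; sym = pathSym }

-- Shift P n one position to the right, so that position 0 is an always-empty left neighbour of
-- vertex 0, and read a set S as its indicator sequence c.  A pair at distance at most 2 is
-- resolved exactly by one window of five consecutive positions, a farther pair by the
-- neighbourhoods of its two ends.  Lower bounds: scanning c from the left, a potential ψ of the
-- last four bits shows A (n + 1) ≤ B ∣ S ∣, with A / B = 1 / 2 for k = 2 and 4 / 5 for k = 3,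
-- every step being a finite check over windows.  Upper bounds: for the even vertices plus the
-- last one the holes of c are more than 1 apart, for the complement of the vertices ≡ 4 (mod 5)
-- having four successors they are more than 4 apart, and then every window resolves enough.
module Submission where

open import Defs hiding (sym)
open import Data.Bool using (Bool; true; false; not; _∧_; _∨_; T; if_then_else_)
open import Data.Bool.Properties using (∧-comm; ∧-zeroʳ; ∧-identityʳ; ∨-identityʳ; ∨-zeroʳ; T-∨; T-≡)
  renaming (_≟_ to _≟ᵇ_)
open import Data.Empty using (⊥-elim)
open import Data.Fin using (Fin; toℕ; fromℕ<)
import Data.Fin as Fin
open import Data.Fin.Properties using (toℕ-injective; toℕ-fromℕ<; toℕ<n)
open import Data.Fin.Subset using (Subset; _∩_; ∣_∣; outside)
open import Data.Nat using (ℕ; zero; suc; _+_; _*_; _∸_; _≤_; _<_; z≤n; s≤s; s≤s⁻¹; _≟_; _≤?_; _≤ᵇ_;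
                            _/_; _%_; ⌈_/2⌉; ⌊_/2⌋)
open import Data.Nat.DivMod using (m≡m%n+[m/n]*n; m%n<n; m/n≡1+[m∸n]/n)
open import Data.Nat.Properties
open import Data.Nat.Tactic.RingSolver using (solve-∀)
open import Data.Product using (_×_; _,_; proj₁; proj₂)
open import Data.Sum using (inj₁; inj₂; [_,_]′)
open import Data.Unit using (tt)
open import Data.Vec using ([]; _∷_; tabulate)
open import Function using (_∘_)
open import Function.Bundles using (Equivalence; mk⇔)
open import Relation.Binary using (tri<; tri≈; tri>)
open import Relation.Binary.PropositionalEquality
open import Relation.Nullary using (Dec; yes; no; does)
open import Relation.Nullary.Decidable using (True; toWitness; _×-dec_; _→-dec_; does-⇔; dec-true; dec-false)

open Equivalence using (to; from)

⟦_⟧ : Bool → ℕ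
⟦ false ⟧ = 0
⟦ true  ⟧ = 1

count : ℕ → (ℕ → Bool) → ℕ
count zero    f = 0
count (suc L) f = ⟦ f 0 ⟧ + count L (f ∘ suc)

⟦⟧≤1 : ∀ b → ⟦ b ⟧ ≤ 1
⟦⟧≤1 false = z≤n
⟦⟧≤1 true  = s≤s z≤n

count-cong : ∀ L {f g} → (∀ i → i < L → f i ≡ g i) → count L f ≡ count L g
count-cong zero    f≗g = refl
count-cong (suc L) f≗g =
  cong₂ _+_ (cong ⟦_⟧ (f≗g 0 (s≤s z≤n))) (count-cong L (λ i i<L → f≗g (suc i) (s≤s i<L)))

count-+ : ∀ m k f → count (m + k) f ≡ count m f + count k (λ i → f (m + i))
count-+ zero    k f = refl
count-+ (suc m) k f = trans (cong (⟦ f 0 ⟧ +_) (count-+ m k (f ∘ suc))) (sym (+-assoc ⟦ f 0 ⟧ _ _))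

count-empty : ∀ L f → (∀ i → i < L → f i ≡ false) → count L f ≡ 0
count-empty zero    f f≡false = refl
count-empty (suc L) f f≡false rewrite f≡false 0 (s≤s z≤n) =
  count-empty L (f ∘ suc) (λ i i<L → f≡false (suc i) (s≤s i<L))

count-all : ∀ L f → (∀ i → i < L → f i ≡ true) → count L f ≡ L
count-all zero    f f≡true = refl
count-all (suc L) f f≡true rewrite f≡true 0 (s≤s z≤n) =
  cong suc (count-all L (f ∘ suc) (λ i i<L → f≡true (suc i) (s≤s i<L)))

count-not : ∀ L f → count L (not ∘ f) + count L f ≡ L
count-not zero    f = refl
count-not (suc L) f with f 0
... | true  = trans (+-suc _ _) (cong suc (count-not L (f ∘ suc)))
... | false = cong suc (count-not L (f ∘ suc))

count-≤-+ : ∀ m k f → count m f ≤ count (m + k) f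
count-≤-+ m k f = ≤-trans (m≤m+n _ _) (≤-reflexive (sym (count-+ m k f)))

count-extend : ∀ L m f → (∀ i → L ≤ i → f i ≡ false) → count (L + m) f ≡ count L f
count-extend L m f vanish = begin
  count (L + m) f                          ≡⟨ count-+ L m f ⟩
  count L f + count m (λ i → f (L + i))    ≡⟨ cong (count L f +_) (count-empty m _ (λ i _ → vanish (L + i) (m≤m+n L i))) ⟩
  count L f + 0                            ≡⟨ +-identityʳ _ ⟩
  count L f                                ∎
  where open ≡-Reasoning

count-window : ∀ p K L f → (∀ i → i < p → f i ≡ false) → (∀ i → p + K ≤ i → f i ≡ false) →
               (∀ i → L ≤ i → f i ≡ false) → count L f ≡ count K (λ i → f (p + i))
count-window p K L f below above beyond = begin
  count L f                                ≡⟨ count-extend L (p + K) f beyond ⟨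
  count (L + (p + K)) f                    ≡⟨ cong (λ M → count M f) (+-comm L (p + K)) ⟩
  count (p + K + L) f                      ≡⟨ count-extend (p + K) L f above ⟩
  count (p + K) f                          ≡⟨ count-+ p K f ⟩
  count p f + count K (λ i → f (p + i))    ≡⟨ cong (_+ count K (λ i → f (p + i))) (count-empty p f below) ⟩
  count K (λ i → f (p + i))                ∎
  where open ≡-Reasoning

count-gapped-≤ : ∀ K s K′ f → count K f + count K′ (λ i → f (K + s + i)) ≤ count (K + s + K′) f
count-gapped-≤ K s K′ f = begin
  count K f + count K′ (λ i → f (K + s + i))        ≤⟨ +-monoˡ-≤ _ (count-≤-+ K s f) ⟩
  count (K + s) f + count K′ (λ i → f (K + s + i))  ≡⟨ count-+ (K + s) K′ f ⟨
  count (K + s + K′) f                              ∎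
  where open ≤-Reasoning

pairwise-∨⇒≤1+count : ∀ K f → (∀ x y → x < y → y < K → T (f x ∨ f y)) → K ≤ suc (count K f)
pairwise-∨⇒≤1+count zero    f pairs = z≤n
pairwise-∨⇒≤1+count (suc K) f pairs with f 0 in f0
... | true  = s≤s (pairwise-∨⇒≤1+count K (f ∘ suc) (λ x y x<y y<K → pairs (suc x) (suc y) (s≤s x<y) (s≤s y<K)))
... | false = s≤s (≤-reflexive (sym (count-all K (f ∘ suc) rest)))
  where
  rest : ∀ i → i < K → f (suc i) ≡ true
  rest i i<K = to T-≡ (subst (λ b → T (b ∨ f (suc i))) f0 (pairs 0 (suc i) (s≤s z≤n) (s≤s i<K)))

-- min (|x - z|, 2), in the shape in which d2 (P n) computes it
dist : ℕ → ℕ → ℕ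
dist x z = if does (x ≟ z) then 0 else (if does (x ≟ suc z) ∨ does (suc x ≟ z) then 1 else 2)

separates : ℕ → ℕ → ℕ → Bool
separates x y z = not (does (dist x z ≟ dist y z))

resolving : (ℕ → Bool) → ℕ → ℕ → ℕ → Bool
resolving c x y z = separates x y z ∧ c z

dist-below : ∀ {x z} → z + 2 ≤ x → dist x z ≡ 2
dist-below {suc (suc x)} {zero}  _            = refl
dist-below {suc zero}    {zero}  (s≤s ())
dist-below {suc x}       {suc z} (s≤s z+2≤x) = dist-below z+2≤x

dist-above : ∀ {x z} → x + 2 ≤ z → dist x z ≡ 2
dist-above {zero}  {suc (suc z)} _            = refl
dist-above {zero}  {suc zero}    (s≤s ())
dist-above {suc x} {suc z}       (s≤s x+2≤z) = dist-above x+2≤z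

dist-+ʳ : ∀ x i → dist x (x + i) ≡ dist 0 i
dist-+ʳ zero    i = refl
dist-+ʳ (suc x) i = dist-+ʳ x i

separates-shift : ∀ j x y z → separates (j + x) (j + y) (j + z) ≡ separates x y z
separates-shift zero    x y z = refl
separates-shift (suc j) x y z = separates-shift j x y z

separates-sym : ∀ x y z → separates x y z ≡ separates y x z
separates-sym x y z = cong not (does-⇔ (mk⇔ sym sym) (dist x z ≟ dist y z) (dist y z ≟ dist x z))

separates-by-dist : ∀ {x y z u v} → dist x z ≡ u → dist y z ≡ v → separates x y z ≡ not (does (u ≟ v))
separates-by-dist refl refl = refl

separates-far-below : ∀ {x y z} → z + 2 ≤ x → z + 2 ≤ y → separates x y z ≡ false
separates-far-below {x} {y} {z} z+2≤x z+2≤y =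
  separates-by-dist {x} {y} {z} (dist-below z+2≤x) (dist-below z+2≤y)

separates-far-above : ∀ {x y z} → x + 2 ≤ z → y + 2 ≤ z → separates x y z ≡ false
separates-far-above {x} {y} {z} x+2≤z y+2≤z =
  separates-by-dist {x} {y} {z} (dist-above x+2≤z) (dist-above y+2≤z)

-- Only the window [j, j + K) resolves (j + x, j + y), and the count is translation invariant.
count-resolving : ∀ L c j x y K → 1 ≤ x → x ≤ y → y + 2 ≤ K → (∀ i → L ≤ i → c i ≡ false) →
                  count L (resolving c (j + x) (j + y)) ≡ count K (resolving (λ i → c (j + i)) x y)
count-resolving L c j x y K 1≤x x≤y y+2≤K vanish =
  trans (count-window j K L (resolving c (j + x) (j + y)) below above beyond)
        (count-cong K (λ i _ → cong (_∧ c (j + i)) (separates-shift j x y i)))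
  where
  below : ∀ i → i < j → resolving c (j + x) (j + y) i ≡ false
  below i i<j = cong (_∧ c i) (separates-far-below (far x 1≤x) (far y (≤-trans 1≤x x≤y)))
    where
    far : ∀ w → 1 ≤ w → i + 2 ≤ j + w
    far w 1≤w = ≤-trans (≤-reflexive (+-suc i 1)) (+-mono-≤ i<j 1≤w)
  above : ∀ i → j + K ≤ i → resolving c (j + x) (j + y) i ≡ false
  above i j+K≤i = cong (_∧ c i) (separates-far-above (far x (≤-trans (+-monoˡ-≤ 2 x≤y) y+2≤K)) (far y y+2≤K))
    where
    far : ∀ w → w + 2 ≤ K → j + w + 2 ≤ i
    far w w+2≤K = ≤-trans (≤-reflexive (+-assoc j w 2)) (≤-trans (+-monoʳ-≤ j w+2≤K) j+K≤i)
  beyond : ∀ i → L ≤ i → resolving c (j + x) (j + y) i ≡ false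
  beyond i L≤i = trans (cong (separates (j + x) (j + y) i ∧_) (vanish i L≤i)) (∧-zeroʳ _)

indicator : ∀ {n} → Subset n → ℕ → Bool
indicator []      z       = false
indicator (b ∷ S) zero    = b
indicator (b ∷ S) (suc z) = indicator S z

pad : ∀ {n} → Subset n → ℕ → Bool
pad S = indicator (outside ∷ S)

indicator-beyond : ∀ {n} (S : Subset n) z → n ≤ z → indicator S z ≡ false
indicator-beyond []      z       _         = refl
indicator-beyond (b ∷ S) (suc z) (s≤s n≤z) = indicator-beyond S z n≤z

pad-beyond : ∀ {n} (S : Subset n) z → suc n ≤ z → pad S z ≡ false
pad-beyond S = indicator-beyond (outside ∷ S)

indicator-tabulate : ∀ {n} (v : Fin n → Bool) (g : ℕ → Bool) → (∀ i → v i ≡ g (toℕ i)) →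
                     ∀ z → z < n → indicator (tabulate v) z ≡ g z
indicator-tabulate v g v≗g zero    (s≤s _)   = v≗g Fin.zero
indicator-tabulate v g v≗g (suc z) (s≤s z<n) =
  indicator-tabulate (v ∘ Fin.suc) (g ∘ suc) (v≗g ∘ Fin.suc) z z<n

indicator-∩ : ∀ {n} (S T : Subset n) z → indicator (S ∩ T) z ≡ indicator S z ∧ indicator T z
indicator-∩ []      []      z       = refl
indicator-∩ (s ∷ S) (t ∷ T) zero    = refl
indicator-∩ (s ∷ S) (t ∷ T) (suc z) = indicator-∩ S T z

∣∣≡count : ∀ {n} (S : Subset n) → ∣ S ∣ ≡ count n (indicator S)
∣∣≡count []          = refl
∣∣≡count (true ∷ S)  = cong suc (∣∣≡count S)
∣∣≡count (false ∷ S) = ∣∣≡count S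

d2≡dist : ∀ {n} (x z : Fin n) → d2 (P n) x z ≡ dist (toℕ x) (toℕ z)
d2≡dist x z rewrite does-⇔ (mk⇔ (cong toℕ) toℕ-injective) (x Fin.≟ z) (toℕ x ≟ toℕ z) = refl

C-indicator : ∀ {n} (x y : Fin n) z → z < n → indicator (C (P n) x y) z ≡ separates (toℕ x) (toℕ y) z
C-indicator x y = indicator-tabulate _ (separates (toℕ x) (toℕ y)) λ z →
  trans (cong₂ (λ u v → if does (u ≟ v) then false else true) (d2≡dist x z) (d2≡dist y z))
        (if-not (does (dist (toℕ x) (toℕ z) ≟ dist (toℕ y) (toℕ z))))
  where
  if-not : ∀ b → (if b then false else true) ≡ not b
  if-not true  = refl
  if-not false = refl

∣∩C∣≡resolving : ∀ {n} (S : Subset n) x y →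
                 ∣ S ∩ C (P n) x y ∣ ≡ count (suc n) (resolving (pad S) (suc (toℕ x)) (suc (toℕ y)))
∣∩C∣≡resolving {n} S x y = begin
  ∣ S ∩ C (P n) x y ∣                                ≡⟨ ∣∣≡count (S ∩ C (P n) x y) ⟩
  count n (indicator (S ∩ C (P n) x y))             ≡⟨ count-cong n resolves ⟩
  count n (λ z → separates a b z ∧ indicator S z)   ≡⟨ cong (λ t → ⟦ t ⟧ + count n (λ z → separates a b z ∧ indicator S z))
                                                            (∧-zeroʳ (separates (suc a) (suc b) 0)) ⟨
  count (suc n) (resolving (pad S) (suc a) (suc b)) ∎
  where
  open ≡-Reasoning
  a b : ℕ
  a = toℕ x
  b = toℕ y
  resolves : ∀ z → z < n → indicator (S ∩ C (P n) x y) z ≡ separates a b z ∧ indicator S z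
  resolves z z<n = begin
    indicator (S ∩ C (P n) x y) z                ≡⟨ indicator-∩ S (C (P n) x y) z ⟩
    indicator S z ∧ indicator (C (P n) x y) z    ≡⟨ ∧-comm (indicator S z) _ ⟩
    indicator (C (P n) x y) z ∧ indicator S z    ≡⟨ cong (_∧ indicator S z) (C-indicator x y z z<n) ⟩
    separates a b z ∧ indicator S z              ∎

∣∩C∣-sym : ∀ {n} (S : Subset n) x y → ∣ S ∩ C (P n) x y ∣ ≡ ∣ S ∩ C (P n) y x ∣
∣∩C∣-sym {n} S x y =
  trans (∣∩C∣≡resolving S x y)
        (trans (count-cong (suc n) λ z _ → cong (_∧ pad S z) (separates-sym (suc (toℕ x)) (suc (toℕ y)) z))
               (sym (∣∩C∣≡resolving S y x)))

-- In padded coordinates the pair (a, a + 1 + d) of P n becomes (a + 1, a + 2 + d).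
ResolvesPairs : ℕ → (n : ℕ) → (ℕ → Bool) → Set
ResolvesPairs k n c = ∀ a d → a + suc d < n → k ≤ count (suc n) (resolving c (a + 1) (a + (2 + d)))

resolving-padded : ∀ c a d → resolving c (suc a) (suc (a + suc d)) ≡ resolving c (a + 1) (a + (2 + d))
resolving-padded c a d = cong₂ (resolving c) (+-comm 1 a) (sym (+-suc a (suc d)))

isAdjGen⇒resolvesPairs : ∀ {n k} (S : Subset n) → IsAdjGen (P n) k S → ResolvesPairs k n (pad S)
isAdjGen⇒resolvesPairs {n} {k} S gen a d b<n =
  subst (k ≤_) (trans (∣∩C∣≡resolving S x y) (cong (count (suc n)) pair≡)) (gen x y x≢y)
  where
  a<n : a < n
  a<n = ≤-trans (s≤s (m≤m+n a (suc d))) b<n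
  x y : Fin n
  x = fromℕ< a<n
  y = fromℕ< b<n
  x≢y : x ≢ y
  x≢y x≡y = <⇒≢ (m<m+n a (s≤s z≤n)) (trans (sym (toℕ-fromℕ< a<n)) (trans (cong toℕ x≡y) (toℕ-fromℕ< b<n)))
  pair≡ : resolving (pad S) (suc (toℕ x)) (suc (toℕ y)) ≡ resolving (pad S) (a + 1) (a + (2 + d))
  pair≡ = trans (cong₂ (λ u v → resolving (pad S) (suc u) (suc v)) (toℕ-fromℕ< a<n) (toℕ-fromℕ< b<n))
                (resolving-padded (pad S) a d)

resolvesPairs⇒ordered : ∀ {n k} (S : Subset n) → ResolvesPairs k n (pad S) →
                        ∀ x y → toℕ x < toℕ y → k ≤ ∣ S ∩ C (P n) x y ∣
resolvesPairs⇒ordered {n} {k} S resolves x y x<y =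
  subst (k ≤_) (sym (trans (∣∩C∣≡resolving S x y) (cong (count (suc n)) pair≡)))
        (resolves a d (subst (_< n) y≡ (toℕ<n y)))
  where
  a d : ℕ
  a = toℕ x
  d = proj₁ (m≤n⇒∃[o]m+o≡n x<y)
  y≡ : toℕ y ≡ a + suc d
  y≡ = sym (trans (+-suc a d) (proj₂ (m≤n⇒∃[o]m+o≡n x<y)))
  pair≡ : resolving (pad S) (suc a) (suc (toℕ y)) ≡ resolving (pad S) (a + 1) (a + (2 + d))
  pair≡ = trans (cong (λ w → resolving (pad S) (suc a) (suc w)) y≡) (resolving-padded (pad S) a d)

resolvesPairs⇒isAdjGen : ∀ {n k} (S : Subset n) → ResolvesPairs k n (pad S) → IsAdjGen (P n) k S
resolvesPairs⇒isAdjGen {n} {k} S resolves x y x≢y with <-cmp (toℕ x) (toℕ y)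
... | tri< x<y _ _ = resolvesPairs⇒ordered S resolves x y x<y
... | tri≈ _ x≡y _ = ⊥-elim (x≢y (toℕ-injective x≡y))
... | tri> _ _ y<x = subst (k ≤_) (∣∩C∣-sym S y x) (resolvesPairs⇒ordered S resolves y x y<x)

∀ᵇ? : {P : Bool → Set} → (∀ b → Dec (P b)) → Dec (∀ b → P b)
∀ᵇ? P? with P? false | P? true
... | yes p₀ | yes p₁ = yes λ { false → p₀ ; true → p₁ }
... | no ¬p₀ | _      = no λ p → ¬p₀ (p false)
... | yes _  | no ¬p₁ = no λ p → ¬p₁ (p true)

word : Bool → Bool → Bool → Bool → Bool → ℕ → Bool
word b₀ b₁ b₂ b₃ b₄ = indicator (b₀ ∷ b₁ ∷ b₂ ∷ b₃ ∷ b₄ ∷ [])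

Words? : {Q : (ℕ → Bool) → Set} → (∀ w → Dec (Q w)) → Dec (∀ b₀ b₁ b₂ b₃ b₄ → Q (word b₀ b₁ b₂ b₃ b₄))
Words? Q? = ∀ᵇ? λ b₀ → ∀ᵇ? λ b₁ → ∀ᵇ? λ b₂ → ∀ᵇ? λ b₃ → ∀ᵇ? λ b₄ → Q? (word b₀ b₁ b₂ b₃ b₄)

-- When Q w only inspects w 0, …, w 4, the result type is Q w up to conversion.
by-evaluation : {Q : (ℕ → Bool) → Set} (Q? : ∀ w → Dec (Q w)) → {True (Words? Q?)} →
                ∀ (w : ℕ → Bool) → Q (word (w 0) (w 1) (w 2) (w 3) (w 4))
by-evaluation Q? {ok} w = toWitness ok (w 0) (w 1) (w 2) (w 3) (w 4)

-- Lower bounds: a potential scan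

ResolvesWindow : ℕ → (ℕ → Bool) → Set
ResolvesWindow k w = k ≤ count 5 (resolving w 1 2) × k ≤ count 5 (resolving w 2 3) × k ≤ count 5 (resolving w 1 3)

ResolvesWindow? : ∀ k w → Dec (ResolvesWindow k w)
ResolvesWindow? k w = (k ≤? _) ×-dec (k ≤? _) ×-dec (k ≤? _)

-- ψ of the current window bounds how far B · count has run ahead of A · length.
module PotentialScan (k A B : ℕ) (ψ : (ℕ → Bool) → ℕ)
  (ψ-last : ∀ w → w 4 ≡ false → ResolvesWindow k w → ψ w + A * 4 ≤ B * count 4 w)
  (ψ-step : ∀ w → ResolvesWindow k w → ψ w + A ≤ ψ (w ∘ suc) + B * ⟦ w 0 ⟧)
  where

  scan : ∀ m c → (∀ i → m + 4 ≤ i → c i ≡ false) → (∀ j → j + 4 ≤ m + 4 → ResolvesWindow k (λ i → c (j + i))) →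
         ψ c + A * (m + 4) ≤ B * count (m + 4) c
  scan zero    c vanish resolved = ψ-last c (vanish 4 ≤-refl) (resolved 0 ≤-refl)
  scan (suc m) c vanish resolved = begin
    ψ c + A * suc (m + 4)                       ≡⟨ cong (ψ c +_) (*-suc A (m + 4)) ⟩
    ψ c + (A + A * (m + 4))                     ≡⟨ +-assoc (ψ c) A _ ⟨
    ψ c + A + A * (m + 4)                       ≤⟨ +-monoˡ-≤ _ (ψ-step c (resolved 0 (m≤n+m 4 (suc m)))) ⟩
    ψ (c ∘ suc) + B * ⟦ c 0 ⟧ + A * (m + 4)     ≡⟨ shuffle (ψ (c ∘ suc)) (B * ⟦ c 0 ⟧) (A * (m + 4)) ⟩
    ψ (c ∘ suc) + A * (m + 4) + B * ⟦ c 0 ⟧     ≤⟨ +-monoˡ-≤ _ (scan m (c ∘ suc) (λ i → vanish (suc i) ∘ s≤s) (λ j → resolved (suc j) ∘ s≤s)) ⟩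
    B * count (m + 4) (c ∘ suc) + B * ⟦ c 0 ⟧   ≡⟨ +-comm (B * count (m + 4) (c ∘ suc)) _ ⟩
    B * ⟦ c 0 ⟧ + B * count (m + 4) (c ∘ suc)   ≡⟨ *-distribˡ-+ B ⟦ c 0 ⟧ _ ⟨
    B * count (suc m + 4) c                     ∎
    where
    open ≤-Reasoning
    shuffle : ∀ x y z → x + y + z ≡ x + z + y
    shuffle = solve-∀

  scan-bound : ∀ L c → 4 ≤ L → (∀ i → L ≤ i → c i ≡ false) → (∀ j → j + 4 ≤ L → ResolvesWindow k (λ i → c (j + i))) →
               A * L ≤ B * count L c
  scan-bound L c 4≤L vanish resolved = subst (λ M → A * M ≤ B * count M c) L≡
    (m+n≤o⇒n≤o (ψ c) (scan m c (λ i → vanish i ∘ ≤-trans (≤-reflexive (sym L≡))) (λ j p → resolved j (≤-trans p (≤-reflexive L≡)))))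
    where
    m : ℕ
    m = L ∸ 4
    L≡ : m + 4 ≡ L
    L≡ = m∸n+n≡m 4≤L

-- Potentials found by a search over the sixteen windows; only the checks below matter.
ψ₂ : (ℕ → Bool) → ℕ
ψ₂ w = ⟦ w 0 ⟧ + ⟦ w 0 ∧ w 1 ⟧ + ⟦ w 1 ∧ w 2 ∧ w 3 ⟧

ψ₂-last : ∀ w → w 4 ≡ false → ResolvesWindow 2 w → ψ₂ w + 1 * 4 ≤ 2 * count 4 w
ψ₂-last w = by-evaluation (λ w → (w 4 ≟ᵇ false) →-dec ResolvesWindow? 2 w →-dec (ψ₂ w + 1 * 4 ≤? 2 * count 4 w)) w

ψ₂-step : ∀ w → ResolvesWindow 2 w → ψ₂ w + 1 ≤ ψ₂ (w ∘ suc) + 2 * ⟦ w 0 ⟧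
ψ₂-step w = by-evaluation (λ w → ResolvesWindow? 2 w →-dec (ψ₂ w + 1 ≤? ψ₂ (w ∘ suc) + 2 * ⟦ w 0 ⟧)) w

ψ₃ : (ℕ → Bool) → ℕ
ψ₃ w = ⟦ w 0 ⟧ + ⟦ w 0 ∧ w 1 ⟧ + ⟦ w 0 ∧ w 1 ∧ w 2 ⟧ + ⟦ w 0 ∧ w 1 ∧ w 2 ∧ w 3 ⟧

ψ₃-last : ∀ w → w 4 ≡ false → ResolvesWindow 3 w → ψ₃ w + 4 * 4 ≤ 5 * count 4 w
ψ₃-last w = by-evaluation (λ w → (w 4 ≟ᵇ false) →-dec ResolvesWindow? 3 w →-dec (ψ₃ w + 4 * 4 ≤? 5 * count 4 w)) w

ψ₃-step : ∀ w → ResolvesWindow 3 w → ψ₃ w + 4 ≤ ψ₃ (w ∘ suc) + 5 * ⟦ w 0 ⟧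
ψ₃-step w = by-evaluation (λ w → ResolvesWindow? 3 w →-dec (ψ₃ w + 4 ≤? ψ₃ (w ∘ suc) + 5 * ⟦ w 0 ⟧)) w

resolvesPairs⇒resolvesWindow : ∀ {k n} c → (∀ i → suc n ≤ i → c i ≡ false) → ResolvesPairs k n c →
                               ∀ j → j + 4 ≤ suc n → ResolvesWindow k (λ i → c (j + i))
resolvesPairs⇒resolvesWindow {k} {n} c vanish resolves j j+4≤1+n =
  translate 1 2 (s≤s z≤n) (s≤s z≤n) (n≤1+n 4) (resolves j 0 (below (+-monoʳ-< j (s≤s (s≤s z≤n))))) ,
  translate 2 3 (s≤s z≤n) (s≤s (s≤s z≤n)) ≤-refl
    (subst (λ r → k ≤ count (suc n) r) (cong₂ (resolving c) (+-assoc j 1 1) (+-assoc j 1 2))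
           (resolves (j + 1) 0 (below (≤-trans (≤-reflexive (cong suc (+-assoc j 1 1))) (+-monoʳ-< j (s≤s (s≤s (s≤s z≤n)))))))) ,
  translate 1 3 (s≤s z≤n) (s≤s z≤n) ≤-refl (resolves j 1 (below (+-monoʳ-< j (s≤s (s≤s (s≤s z≤n))))))
  where
  below : ∀ {m} → m < j + 3 → m < n
  below m<j+3 = ≤-trans m<j+3 (s≤s⁻¹ (subst (_≤ suc n) (+-suc j 3) j+4≤1+n))
  translate : ∀ x y → 1 ≤ x → x ≤ y → y + 2 ≤ 5 → k ≤ count (suc n) (resolving c (j + x) (j + y)) →
              k ≤ count 5 (resolving (λ i → c (j + i)) x y)
  translate x y 1≤x x≤y y+2≤5 = subst (k ≤_) (count-resolving (suc n) c j x y 5 1≤x x≤y y+2≤5 vanish)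

isAdjGen⇒card≥ : ∀ k A B (ψ : (ℕ → Bool) → ℕ) →
                 (∀ w → w 4 ≡ false → ResolvesWindow k w → ψ w + A * 4 ≤ B * count 4 w) →
                 (∀ w → ResolvesWindow k w → ψ w + A ≤ ψ (w ∘ suc) + B * ⟦ w 0 ⟧) →
                 ∀ {n} (S : Subset n) → 3 ≤ n → IsAdjGen (P n) k S → A * suc n ≤ B * ∣ S ∣
isAdjGen⇒card≥ k A B ψ ψ-last ψ-step {n} S 3≤n gen =
  subst (λ m → A * suc n ≤ B * m) (sym (∣∣≡count S))
        (scan-bound (suc n) (pad S) (s≤s 3≤n) (pad-beyond S)
                    (resolvesPairs⇒resolvesWindow (pad S) (pad-beyond S) (isAdjGen⇒resolvesPairs S gen)))
  where open PotentialScan k A B ψ ψ-last ψ-step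

-- Upper bounds: sequences with sparse holes

HolesApart : ℕ → ℕ → (ℕ → Bool) → Set
HolesApart d L c = ∀ x y → x < y → y ≤ x + d → y ≤ L → T (c x ∨ c y)

holesApart-window : ∀ {d L} c → HolesApart d L c → ∀ j x K → K ≤ suc d → j + (x + K) ≤ suc L →
                    K ≤ suc (count K (λ i → c (j + (x + i))))
holesApart-window {d} {L} c holes j x K K≤1+d fits = pairwise-∨⇒≤1+count K _ λ u v u<v v<K →
  holes (j + (x + u)) (j + (x + v)) (+-monoʳ-< j (+-monoʳ-< x u<v))
        (≤-trans (+-monoʳ-≤ j (+-monoʳ-≤ x (≤-trans (s≤s⁻¹ (≤-trans v<K K≤1+d)) (m≤n+m d u))))
                 (≤-reflexive (trans (cong (j +_) (sym (+-assoc x u d))) (sym (+-assoc j (x + u) d)))))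
        (s≤s⁻¹ (≤-trans (+-monoʳ-< j (+-monoʳ-< x v<K)) fits))

module _ {L} (c : ℕ → Bool) (vanish : ∀ i → L ≤ i → c i ≡ false) (a : ℕ) where

  resolving-adjacent : count L (resolving c (a + 1) (a + 2)) ≡ count 4 (λ i → c (a + i))
  resolving-adjacent = count-resolving L c a 1 2 4 (s≤s z≤n) (s≤s z≤n) ≤-refl vanish

  resolving-gap : count L (resolving c (a + 1) (a + 3)) ≡ count 5 (resolving (λ i → c (a + i)) 1 3)
  resolving-gap = count-resolving L c a 1 3 5 (s≤s z≤n) (s≤s z≤n) ≤-refl vanish

  resolving-far : ∀ e → count 3 (λ i → c (a + i)) + count 2 (λ i → c (a + (4 + e + i)))
                        ≤ count L (resolving c (a + 1) (a + (4 + e)))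
  resolving-far e = begin
    count 3 w + count 2 (λ i → w (4 + e + i))          ≡⟨ cong (count 3 w +_) (count-cong 2 right) ⟩
    count 3 r + count 2 (λ i → r (3 + (1 + e) + i))    ≤⟨ count-gapped-≤ 3 (1 + e) 2 r ⟩
    count (3 + (1 + e) + 2) r                          ≡⟨ count-resolving L c a 1 (4 + e) _ (s≤s z≤n) (s≤s z≤n) ≤-refl vanish ⟨
    count L (resolving c (a + 1) (a + (4 + e)))        ∎
    where
    open ≤-Reasoning
    w r : ℕ → Bool
    w i = c (a + i)
    r = resolving w 1 (4 + e)
    -- both positions are at distance 2 from the left end, but at distance 0 and 1 from the right end
    right : ∀ i → i < 2 → w (4 + e + i) ≡ r (4 + e + i)
    right 0 _ = cong (_∧ w (4 + e + 0)) (sym (separates-by-dist {1} {4 + e} {4 + e + 0} refl (dist-+ʳ (4 + e) 0)))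
    right 1 _ = cong (_∧ w (4 + e + 1)) (sym (separates-by-dist {1} {4 + e} {4 + e + 1} refl (dist-+ʳ (4 + e) 1)))
    right (suc (suc i)) (s≤s (s≤s ()))

gap+middle : ∀ w → count 5 (resolving w 1 3) + ⟦ w 2 ⟧ ≡ count 5 w
gap+middle w = by-evaluation (λ w → count 5 (resolving w 1 3) + ⟦ w 2 ⟧ ≟ count 5 w) w

gap-halves : ∀ w → count 5 (resolving w 1 3) ≡ count 2 w + count 2 (λ i → w (3 + i))
gap-halves w = by-evaluation (λ w → count 5 (resolving w 1 3) ≟ count 2 w + count 2 (λ i → w (3 + i))) w

module _ {n} (c : ℕ → Bool) (vanish : ∀ i → suc n ≤ i → c i ≡ false) where

  private
    window : ∀ {d} → HolesApart d (suc n) c → ∀ a e x K → a + suc e < n → K ≤ suc d → x + K ≤ e + 4 →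
             K ≤ suc (count K (λ i → c (a + (x + i))))
    window holes a e x K b<n K≤1+d x+K≤e+4 = holesApart-window c holes a x K K≤1+d
      (≤-trans (+-monoʳ-≤ a x+K≤e+4) (≤-trans (≤-reflexive (shape a e)) (≤-trans (+-monoˡ-≤ 2 b<n) (≤-reflexive (+-comm n 2)))))
      where
      shape : ∀ a e → a + (e + 4) ≡ suc (a + suc e) + 2
      shape = solve-∀

    far-fits : ∀ e → 4 + e + 2 ≤ 2 + e + 4
    far-fits e = ≤-reflexive (shape e)
      where
      shape : ∀ e → 4 + e + 2 ≡ 2 + e + 4
      shape = solve-∀

  holesApart⇒resolvesPairs₂ : HolesApart 1 (suc n) c → ResolvesPairs 2 n c
  holesApart⇒resolvesPairs₂ holes a zero b<n =
    subst (2 ≤_) (sym (trans (resolving-adjacent c vanish a) (count-+ 2 2 (λ i → c (a + i)))))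
          (+-mono-≤ (s≤s⁻¹ (window holes a 0 0 2 b<n ≤-refl (s≤s (s≤s z≤n))))
                    (s≤s⁻¹ (window holes a 0 2 2 b<n ≤-refl ≤-refl)))
  holesApart⇒resolvesPairs₂ holes a (suc zero) b<n =
    subst (2 ≤_) (sym (trans (resolving-gap c vanish a) (gap-halves (λ i → c (a + i)))))
          (+-mono-≤ (s≤s⁻¹ (window holes a 1 0 2 b<n ≤-refl (s≤s (s≤s z≤n))))
                    (s≤s⁻¹ (window holes a 1 3 2 b<n ≤-refl ≤-refl)))
  holesApart⇒resolvesPairs₂ holes a (suc (suc e)) b<n =
    ≤-trans (+-mono-≤ (≤-trans (s≤s⁻¹ (window holes a (2 + e) 0 2 b<n ≤-refl (s≤s (s≤s z≤n)))) (count-≤-+ 2 1 (λ i → c (a + i))))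
                      (s≤s⁻¹ (window holes a (2 + e) (4 + e) 2 b<n ≤-refl (far-fits e))))
            (resolving-far c vanish a e)

  holesApart⇒resolvesPairs₃ : HolesApart 4 (suc n) c → ResolvesPairs 3 n c
  holesApart⇒resolvesPairs₃ holes a zero b<n =
    subst (3 ≤_) (sym (resolving-adjacent c vanish a)) (s≤s⁻¹ (window holes a 0 0 4 b<n (n≤1+n 4) ≤-refl))
  holesApart⇒resolvesPairs₃ holes a (suc zero) b<n =
    subst (3 ≤_) (sym (resolving-gap c vanish a)) (s≤s⁻¹ (begin
      4                                      ≤⟨ s≤s⁻¹ (window holes a 1 0 5 b<n ≤-refl ≤-refl) ⟩
      count 5 w                              ≡⟨ gap+middle w ⟨
      count 5 (resolving w 1 3) + ⟦ w 2 ⟧    ≤⟨ +-monoʳ-≤ _ (⟦⟧≤1 (w 2)) ⟩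
      count 5 (resolving w 1 3) + 1          ≡⟨ +-comm _ 1 ⟩
      suc (count 5 (resolving w 1 3))        ∎))
    where
    open ≤-Reasoning
    w : ℕ → Bool
    w i = c (a + i)
  holesApart⇒resolvesPairs₃ holes a (suc (suc e)) b<n =
    ≤-trans (+-mono-≤ (s≤s⁻¹ (window holes a (2 + e) 0 3 b<n (s≤s (s≤s (s≤s z≤n))) (≤-trans (n≤1+n 3) (m≤n+m 4 (2 + e)))))
                      (s≤s⁻¹ (window holes a (2 + e) (4 + e) 2 b<n (s≤s (s≤s z≤n)) (far-fits e))))
            (resolving-far c vanish a e)

-- The two extremal sets

fromPadded : (n : ℕ) → (ℕ → Bool) → Subset n
fromPadded n g = tabulate (λ i → g (suc (toℕ i)))

pad-fromPadded : ∀ n g x → g 0 ≡ false → x ≤ n → pad (fromPadded n g) x ≡ g x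
pad-fromPadded n g zero    g0 _   = sym g0
pad-fromPadded n g (suc z) g0 z<n = indicator-tabulate _ (g ∘ suc) (λ _ → refl) z z<n

∣fromPadded∣ : ∀ n g → ∣ fromPadded n g ∣ ≡ count n (g ∘ suc)
∣fromPadded∣ n g = trans (∣∣≡count (fromPadded n g)) (count-cong n (indicator-tabulate _ (g ∘ suc) (λ _ → refl)))

∨-introˡ : ∀ {a} b → T a → T (a ∨ b)
∨-introˡ b t = from T-∨ (inj₁ t)

∨-introʳ : ∀ a {b} → T b → T (a ∨ b)
∨-introʳ a t = from (T-∨ {a}) (inj₂ t)

odd : ℕ → Bool
odd zero          = false
odd (suc zero)    = true
odd (suc (suc x)) = odd x

odd-∨ : ∀ x → T (odd x ∨ odd (suc x))
odd-∨ zero          = tt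
odd-∨ (suc zero)    = tt
odd-∨ (suc (suc x)) = odd-∨ x

count-odd : ∀ m → count m (odd ∘ suc) ≡ ⌈ m /2⌉
count-odd zero          = refl
count-odd (suc zero)    = refl
count-odd (suc (suc m)) = cong suc (count-odd m)

-- In padded coordinates: the even vertices and the last vertex of P n.
oddOrLast : ℕ → ℕ → Bool
oddOrLast n x = odd x ∨ does (x ≟ n)

S₂ : (n : ℕ) → Subset n
S₂ n = fromPadded n (oddOrLast n)

S₂-member : ∀ m z → z ≤ suc m → T (oddOrLast (suc m) z) → T (pad (S₂ (suc m)) z)
S₂-member m z z≤1+m = subst T (sym (pad-fromPadded (suc m) (oddOrLast (suc m)) z refl z≤1+m))

S₂-holesApart : ∀ n → 1 ≤ n → HolesApart 1 (suc n) (pad (S₂ n))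
S₂-holesApart (suc m) _ x y x<y y≤x+1 y≤1+n
  with ≤-antisym (≤-trans y≤x+1 (≤-reflexive (+-comm x 1))) x<y
... | refl with m≤n⇒m<n∨m≡n (s≤s⁻¹ y≤1+n)
...   | inj₁ x<n  = [ (λ t → ∨-introˡ _ (S₂-member m x (<⇒≤ x<n) (∨-introˡ _ t)))
                    , (λ t → ∨-introʳ _ (S₂-member m (suc x) x<n (∨-introˡ _ t))) ]′
                    (to (T-∨ {odd x}) (odd-∨ x))
...   | inj₂ refl = ∨-introˡ _ (S₂-member m x ≤-refl (∨-introʳ (odd x) (from T-≡ (dec-true (x ≟ x) refl))))

∣S₂∣ : ∀ m → ∣ S₂ (suc m) ∣ ≡ ⌈ suc m + 1 /2⌉
∣S₂∣ m = begin
  ∣ S₂ (suc m) ∣                                         ≡⟨ ∣fromPadded∣ (suc m) g ⟩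
  count (suc m) (g ∘ suc)                                ≡⟨ cong (λ L → count L (g ∘ suc)) (+-comm 1 m) ⟩
  count (m + 1) (g ∘ suc)                                ≡⟨ count-+ m 1 (g ∘ suc) ⟩
  count m (g ∘ suc) + count 1 (λ i → g (suc (m + i)))    ≡⟨ cong₂ _+_ (count-cong m inner) last ⟩
  count m (odd ∘ suc) + 1                                ≡⟨ cong (_+ 1) (count-odd m) ⟩
  ⌈ m /2⌉ + 1                                            ≡⟨ +-comm _ 1 ⟩
  suc ⌊ suc m /2⌋                                        ≡⟨ cong (λ k → suc ⌊ k /2⌋) (+-comm 1 m) ⟩
  ⌈ suc m + 1 /2⌉                                        ∎
  where
  open ≡-Reasoning
  g : ℕ → Bool
  g = oddOrLast (suc m)
  inner : ∀ z → z < m → g (suc z) ≡ odd (suc z)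
  inner z z<m = trans (cong (odd (suc z) ∨_) (dec-false (suc z ≟ suc m) (<⇒≢ (s≤s z<m)))) (∨-identityʳ _)
  last : count 1 (λ i → g (suc (m + i))) ≡ 1
  last = begin
    ⟦ g (suc (m + 0)) ⟧ + 0                      ≡⟨ cong (λ k → ⟦ g (suc k) ⟧ + 0) (+-identityʳ m) ⟩
    ⟦ odd (suc m) ∨ does (suc m ≟ suc m) ⟧ + 0   ≡⟨ cong (λ b → ⟦ odd (suc m) ∨ b ⟧ + 0) (dec-true (suc m ≟ suc m) refl) ⟩
    ⟦ odd (suc m) ∨ true ⟧ + 0                   ≡⟨ cong (λ b → ⟦ b ⟧ + 0) (∨-zeroʳ (odd (suc m))) ⟩
    1                                            ∎

mult5 : ℕ → Bool
mult5 zero                            = true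
mult5 1                               = false
mult5 2                               = false
mult5 3                               = false
mult5 4                               = false
mult5 (suc (suc (suc (suc (suc x))))) = mult5 x

mult5-gap : ∀ x d → mult5 x ≡ true → 1 ≤ d → d ≤ 4 → mult5 (x + d) ≡ false
mult5-gap zero 1 _ _ _ = refl
mult5-gap zero 2 _ _ _ = refl
mult5-gap zero 3 _ _ _ = refl
mult5-gap zero 4 _ _ _ = refl
mult5-gap zero (suc (suc (suc (suc (suc d))))) _ _ (s≤s (s≤s (s≤s (s≤s ()))))
mult5-gap (suc (suc (suc (suc (suc x))))) d m5 = mult5-gap x d m5

count-mult5 : ∀ t → count t (mult5 ∘ suc) ≡ t / 5
count-mult5 0 = refl
count-mult5 1 = refl
count-mult5 2 = refl
count-mult5 3 = refl
count-mult5 4 = refl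
count-mult5 (suc (suc (suc (suc (suc t))))) = trans (cong suc (count-mult5 t)) (sym (m/n≡1+[m∸n]/n (m≤m+n 5 t)))

-- In padded coordinates the holes are the multiples of 5 followed by four positions of P n;
-- position 0 is one of them.
nonMult5 : ℕ → ℕ → Bool
nonMult5 n x = not (mult5 x ∧ does (x + 4 ≤? n))

S₃ : (n : ℕ) → Subset n
S₃ n = fromPadded n (nonMult5 n)

nonMult5-hole : ∀ n x → nonMult5 n x ≡ false → mult5 x ≡ true × x + 4 ≤ n
nonMult5-hole n x hole with mult5 x | x + 4 ≤ᵇ n in fits
nonMult5-hole n x hole | true  | true  = refl , ≤ᵇ⇒≤ (x + 4) n (subst T (sym fits) tt)
nonMult5-hole n x ()   | true  | false
nonMult5-hole n x ()   | false | _

S₃-holesApart : ∀ n → 4 ≤ n → HolesApart 4 (suc n) (pad (S₃ n))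
S₃-holesApart n 4≤n x y x<y y≤x+4 y≤1+n with pad (S₃ n) x in px
... | true  = tt
... | false = subst T (sym (pad-fromPadded n (nonMult5 n) y g0 y≤n))
                (subst (λ b → T (not (b ∧ does (y + 4 ≤? n)))) (sym y-member) tt)
  where
  g0 : nonMult5 n 0 ≡ false
  g0 = cong not (dec-true (4 ≤? n) 4≤n)
  x≤n : x ≤ n
  x≤n = s≤s⁻¹ (≤-trans x<y y≤1+n)
  x-hole : mult5 x ≡ true × x + 4 ≤ n
  x-hole = nonMult5-hole n x (trans (sym (pad-fromPadded n (nonMult5 n) x g0 x≤n)) px)
  y≤n : y ≤ n
  y≤n = ≤-trans y≤x+4 (proj₂ x-hole)
  y-member : mult5 y ≡ false
  y-member = subst (λ z → mult5 z ≡ false) (m+[n∸m]≡n (<⇒≤ x<y))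
               (mult5-gap x (y ∸ x) (proj₁ x-hole) (m<n⇒0<n∸m x<y) (m≤n+o⇒m∸n≤o y x y≤x+4))

∣S₃∣ : ∀ n → 4 ≤ n → ∣ S₃ n ∣ ≡ n ∸ (n ∸ 4) / 5
∣S₃∣ n 4≤n = begin
  ∣ S₃ n ∣                                             ≡⟨ ∣fromPadded∣ n (nonMult5 n) ⟩
  count n (not ∘ hole)                                 ≡⟨ m+n∸n≡m _ (count n hole) ⟨
  count n (not ∘ hole) + count n hole ∸ count n hole   ≡⟨ cong₂ _∸_ (count-not n hole) holes ⟩
  n ∸ t / 5                                            ∎
  where
  open ≡-Reasoning
  t : ℕ
  t = n ∸ 4
  hole : ℕ → Bool
  hole z = mult5 (suc z) ∧ does (suc z + 4 ≤? n)
  t+4≡n : t + 4 ≡ n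
  t+4≡n = m∸n+n≡m 4≤n
  holes : count n hole ≡ t / 5
  holes = begin
    count n hole              ≡⟨ cong (λ L → count L hole) t+4≡n ⟨
    count (t + 4) hole        ≡⟨ count-extend t 4 hole (λ i t≤i → trans (cong (mult5 (suc i) ∧_)
                                   (dec-false (suc i + 4 ≤? n) (<⇒≱ (subst (_< suc i + 4) t+4≡n (s≤s (+-monoˡ-≤ 4 t≤i))))))
                                   (∧-zeroʳ _)) ⟩
    count t hole              ≡⟨ count-cong t (λ i i<t → trans (cong (mult5 (suc i) ∧_)
                                   (dec-true (suc i + 4 ≤? n) (subst (suc i + 4 ≤_) t+4≡n (+-monoˡ-≤ 4 i<t))))
                                   (∧-identityʳ _)) ⟩
    count t (mult5 ∘ suc)     ≡⟨ count-mult5 t ⟩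
    t / 5                     ∎

m≤2w⇒⌈m/2⌉≤w : ∀ m w → m ≤ 2 * w → ⌈ m /2⌉ ≤ w
m≤2w⇒⌈m/2⌉≤w m w m≤2w = subst (⌈ m /2⌉ ≤_) (sym (n≡⌈n+n/2⌉ w))
                         (⌈n/2⌉-mono (subst (m ≤_) (cong (w +_) (+-identityʳ w)) m≤2w))

-- With r the remainder of n ∸ 4 modulo 5, integrality turns 4 (n + 1) ≤ 5 w into the bound since 5 r < 5 + 4 r.
4[1+n]≤5w⇒n∸[n∸4]/5≤w : ∀ n w → 4 ≤ n → 4 * suc n ≤ 5 * w → n ∸ (n ∸ 4) / 5 ≤ w
4[1+n]≤5w⇒n∸[n∸4]/5≤w n w 4≤n bound = m≤n+o⇒m∸n≤o n q (begin
  n                          ≡⟨ n≡ ⟩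
  4 + (r + q * 5)            ≡⟨ split r q ⟩
  4 + r + 4 * q + q          ≤⟨ +-monoˡ-≤ q (*-cancelˡ-< 5 _ _ five) ⟩
  w + q                      ≡⟨ +-comm w q ⟩
  q + w                      ∎)
  where
  open ≤-Reasoning
  t q r : ℕ
  t = n ∸ 4
  q = t / 5
  r = t % 5
  n≡ : n ≡ 4 + (r + q * 5)
  n≡ = trans (sym (m+[n∸m]≡n 4≤n)) (cong (4 +_) (m≡m%n+[m/n]*n t 5))
  split : ∀ r q → 4 + (r + q * 5) ≡ 4 + r + 4 * q + q
  split = solve-∀
  lhs : ∀ r q → 5 * (3 + r + 4 * q) ≡ (15 + 5 * r) + 20 * q
  lhs = solve-∀
  rhs : ∀ r q → 4 * suc (4 + (r + q * 5)) ≡ (20 + 4 * r) + 20 * q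
  rhs = solve-∀
  regroup : ∀ r → 15 + 5 * r ≡ 15 + r + 4 * r
  regroup = solve-∀
  small : 15 + 5 * r < 20 + 4 * r
  small = subst (_< 20 + 4 * r) (sym (regroup r)) (+-monoˡ-< (4 * r) (+-monoʳ-< 15 (m%n<n t 5)))
  five : 5 * (3 + r + 4 * q) < 5 * w
  five = begin-strict
    5 * (3 + r + 4 * q)        ≡⟨ lhs r q ⟩
    (15 + 5 * r) + 20 * q      <⟨ +-monoˡ-< (20 * q) small ⟩
    (20 + 4 * r) + 20 * q      ≡⟨ rhs r q ⟨
    4 * suc (4 + (r + q * 5))  ≡⟨ cong (λ m → 4 * suc m) n≡ ⟨
    4 * suc n                  ≤⟨ bound ⟩
    5 * w                      ∎

proposition32 : (n : ℕ) → 4 ≤ n →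
    AdimIs (P n) 2 ⌈ n + 1 /2⌉ × AdimIs (P n) 3 (n ∸ ((n ∸ 4) / 5))
proposition32 n@(suc m) 4≤n =
  ((S₂ n , resolvesPairs⇒isAdjGen (S₂ n) (holesApart⇒resolvesPairs₂ (pad (S₂ n)) (pad-beyond (S₂ n)) (S₂-holesApart n (s≤s z≤n)))
         , ∣S₂∣ m)
  , λ S gen → m≤2w⇒⌈m/2⌉≤w (n + 1) ∣ S ∣ (subst (_≤ 2 * ∣ S ∣) (trans (*-identityˡ (suc n)) (+-comm 1 n))
                                           (isAdjGen⇒card≥ 2 1 2 ψ₂ ψ₂-last ψ₂-step S 3≤n gen))) ,
  ((S₃ n , resolvesPairs⇒isAdjGen (S₃ n) (holesApart⇒resolvesPairs₃ (pad (S₃ n)) (pad-beyond (S₃ n)) (S₃-holesApart n 4≤n))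
         , ∣S₃∣ n 4≤n)
  , λ S gen → 4[1+n]≤5w⇒n∸[n∸4]/5≤w n ∣ S ∣ 4≤n (isAdjGen⇒card≥ 3 4 5 ψ₃ ψ₃-last ψ₃-step S 3≤n gen))
  where
  3≤n : 3 ≤ n
  3≤n = ≤-trans (n≤1+n 3) 4≤n
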